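{- Let $p\ge 3$ be a prime and $m\le -1$ an integer, and define integers $d_m(n)$ by $$\frac{1}{(1-x)^{m}}\prod_{i=0}^{\infty}\frac{1}{(1-x^{p^{i}})^{(p-1)m}}=\sum_{n=0}^{\infty}d_{m}(n)x^{n}.$$ Then $d_m(n)\neq 0$ for every integer $n\ge 0$. -}

module Defs where

open import Data.Nat as ℕ using (ℕ; zero; suc; _∸_; _^_)
open import Data.Nat.Divisibility using (_∣?_)
open import Data.Integer as ℤ using (ℤ; +_; -[1+_]; _*_; _+_; -_)
open import Data.List using (List; upTo; map; foldr)
open import Data.Bool using (if_then_else_)
open import Relation.Nullary using (does)

Series : Set
Series = ℕ → ℤ

one : Series
one zero    = + 1
one (suc _) = + 0

_⊛_ : Series → Series → Series
(f ⊛ g) n = foldr _+_ (+ 0) (map (λ i → f i * g (n ∸ i)) (upTo (suc n)))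

spow : Series → ℕ → Series
spow f zero    = one
spow f (suc k) = f ⊛ spow f k

-- the polynomial 1 - x^a  (used for a ≥ 1)
oneMinusXPow : ℕ → Series
oneMinusXPow a zero = + 1
oneMinusXPow a (suc n) = if does (suc n ℕ.≟ a) then - (+ 1) else + 0

-- the series 1/(1 - x^a) = Σ_j x^{ja}  (used for a ≥ 1)
geom : ℕ → Series
geom a n = if does (a ∣? n) then + 1 else + 0

-- (1 - x^a)^e for an integer exponent e (a ≥ 1)
factorPow : ℕ → ℤ → Series
factorPow a (+ k)     = spow (oneMinusXPow a) k
factorPow a -[1+ k ]  = spow (geom a) (suc k)

-- Factors with p^i > n are ≡ 1 mod x^{n+1}, so the product over
-- i = 0..n (where p^i > n already for i = n) gives the exact coefficient.
d : ℕ → ℤ → ℕ → ℤ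
d p m n =
  (factorPow 1 (- m)
    ⊛ foldr _⊛_ one
        (map (λ i → factorPow (p ^ i) (- ((+ (p ∸ 1)) * m))) (upTo (suc n))))
  n

private
  open import Relation.Binary.PropositionalEquality using (_≡_; refl)
  t0 : d 3 -[1+ 0 ] 0 ≡ + 1
  t0 = refl
  t1 : d 3 -[1+ 0 ] 1 ≡ -[1+ 2 ]
  t1 = refl
  t2 : d 3 -[1+ 0 ] 2 ≡ + 3
  t2 = refl

-- Substituting x ↦ -x multiplies d_m(n) by (-1)^n. As p is odd, so is every p^i, and for
-- m = -k the substitution turns the generating function into (1+x)^k ∏_i (1+x^{p^i})^{(p-1)k},
-- a series with nonnegative coefficients. In ∏_{i<L} (1+x^{p^i})^{p-1} the coefficient of x^t
-- is positive for every t < p^L, since the base-p digits of t are at most p-1. Hence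
-- (-1)^n d_m(n) ≥ 1.
module Submission where

open import Defs
open import Data.Nat using (ℕ; _≤_)
open import Data.Nat.Primality using (Prime)
open import Data.Integer using (ℤ; -[1+_]; +_)
open import Data.Integer as ℤ using ()
open import Relation.Binary.PropositionalEquality using (_≢_)

open import Data.Empty using (⊥-elim)
open import Data.Integer using (0ℤ; 1ℤ; -1ℤ; _+_; _*_; _^_; -_; +≤+)
import Data.Integer.Properties as ℤ
open import Algebra.Properties.CommutativeSemigroup ℤ.*-commutativeSemigroup using (interchange)
open import Data.List using (List; []; _∷_; foldr; map; upTo; applyUpTo)
open import Data.List.Membership.Propositional using (_∈_)
open import Data.List.Membership.Propositional.Properties using (∈-map⁺; ∈-upTo⁺)
open import Data.List.Properties using (map-∘; map-cong; map-cong-local; map-upTo)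
open import Data.List.Relation.Unary.All using (All; []; _∷_; universal)
open import Data.List.Relation.Unary.All.Properties using (map⁺; applyUpTo⁺₁; applyUpTo⁺₂)
open import Data.List.Relation.Unary.Any using (here; there)
open import Data.Nat as ℕ using (zero; suc; _∸_; _<_; z≤n; s≤s; NonZero)
import Data.Nat.Properties as ℕ
open import Data.Nat.DivMod using (_%_; _/_; m≡m%n+[m/n]*n; m%n<n; m<n*o⇒m/o<n)
open import Data.Nat.Divisibility using (_∤_; _∣0; ∣-refl; ∣1⇒≡1; ∣m∣n⇒∣m+n; >⇒∤)
open import Data.Nat.Primality using (prime[2]; ¬prime[1]; euclidsLemma; composite; composite⇒¬prime)
import Data.Nat.Tactic.RingSolver as ℕ-Solver
open import Data.Sum using ([_,_]′)
open import Function using (_∘_; id)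
open import Relation.Binary.PropositionalEquality
  using (_≡_; refl; sym; trans; cong; subst; _≗_; module ≡-Reasoning)
open import Relation.Nullary using (yes; no)
open import Relation.Nullary.Decidable using (dec-true; dec-false)

sumℤ : List ℤ → ℤ
sumℤ = foldr _+_ 0ℤ

∏ : List Series → Series
∏ = foldr _⊛_ one

alternate : Series → Series
alternate f n = -1ℤ ^ n * f n

NonNegative : Series → Set
NonNegative f = ∀ n → 0ℤ ℤ.≤ f n

*-distribˡ-sumℤ : ∀ c xs → c * sumℤ xs ≡ sumℤ (map (c *_) xs)
*-distribˡ-sumℤ c []       = ℤ.*-zeroʳ c
*-distribˡ-sumℤ c (x ∷ xs) =
  trans (ℤ.*-distribˡ-+ c x (sumℤ xs)) (cong (λ s → c * x + s) (*-distribˡ-sumℤ c xs))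

sumℤ-nonNeg : ∀ {xs} → All (0ℤ ℤ.≤_) xs → 0ℤ ℤ.≤ sumℤ xs
sumℤ-nonNeg []           = ℤ.≤-refl
sumℤ-nonNeg (x≥0 ∷ xs≥0) = ℤ.+-mono-≤ x≥0 (sumℤ-nonNeg xs≥0)

∈⇒≤sumℤ : ∀ {x xs} → All (0ℤ ℤ.≤_) xs → x ∈ xs → x ℤ.≤ sumℤ xs
∈⇒≤sumℤ {x} (_ ∷ xs≥0) (here refl) = ℤ.i≤i+j x _ ⦃ ℤ.nonNegative (sumℤ-nonNeg xs≥0) ⦄
∈⇒≤sumℤ (y≥0 ∷ xs≥0) (there x∈xs) =
  ℤ.i≤j⇒i≤k+j _ ⦃ ℤ.nonNegative y≥0 ⦄ (∈⇒≤sumℤ xs≥0 x∈xs)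

0≤i*j : ∀ {i j} → 0ℤ ℤ.≤ i → 0ℤ ℤ.≤ j → 0ℤ ℤ.≤ i * j
0≤i*j {+ m} {+ n} _ _ = subst (0ℤ ℤ.≤_) (ℤ.pos-* m n) (+≤+ z≤n)

1≤i*j : ∀ {i j} → 1ℤ ℤ.≤ i → 1ℤ ℤ.≤ j → 1ℤ ℤ.≤ i * j
1≤i*j {+ m} {+ n} (+≤+ 1≤m) (+≤+ 1≤n) = subst (1ℤ ℤ.≤_) (ℤ.pos-* m n) (+≤+ (ℕ.*-mono-≤ 1≤m 1≤n))

⊛-congʳ : ∀ f {g h} → g ≗ h → f ⊛ g ≗ f ⊛ h
⊛-congʳ f g≗h n = cong sumℤ (map-cong (λ i → cong (f i *_) (g≗h (n ∸ i))) (upTo (suc n)))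

alternate-⊛ : ∀ f g → alternate (f ⊛ g) ≗ alternate f ⊛ alternate g
alternate-⊛ f g n = begin
  -1ℤ ^ n * sumℤ (map term (upTo (suc n)))
    ≡⟨ *-distribˡ-sumℤ (-1ℤ ^ n) (map term (upTo (suc n))) ⟩
  sumℤ (map (-1ℤ ^ n *_) (map term (upTo (suc n))))
    ≡⟨ cong sumℤ (map-∘ {g = -1ℤ ^ n *_} {f = term} (upTo (suc n))) ⟨
  sumℤ (map (λ i → -1ℤ ^ n * term i) (upTo (suc n)))
    ≡⟨ cong sumℤ (map-cong-local (applyUpTo⁺₁ id (suc n) (split ∘ ℕ.s≤s⁻¹))) ⟩
  (alternate f ⊛ alternate g) n ∎
  where
  open ≡-Reasoning
  term : ℕ → ℤ
  term i = f i * g (n ∸ i)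
  split : ∀ {i} → i ≤ n → -1ℤ ^ n * term i ≡ alternate f i * alternate g (n ∸ i)
  split {i} i≤n = begin
    -1ℤ ^ n * term i                         ≡⟨ cong (λ k → -1ℤ ^ k * term i) (ℕ.m+[n∸m]≡n i≤n) ⟨
    -1ℤ ^ (i ℕ.+ (n ∸ i)) * term i           ≡⟨ cong (_* term i) (ℤ.^-distribˡ-+-* -1ℤ i (n ∸ i)) ⟩
    -1ℤ ^ i * -1ℤ ^ (n ∸ i) * term i         ≡⟨ interchange (-1ℤ ^ i) (-1ℤ ^ (n ∸ i)) (f i) (g (n ∸ i)) ⟩
    alternate f i * alternate g (n ∸ i)     ∎

alternate-one : alternate one ≗ one
alternate-one zero    = refl
alternate-one (suc n) = ℤ.*-zeroʳ (-1ℤ ^ suc n)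

alternate-spow : ∀ f k → alternate (spow f k) ≗ spow (alternate f) k
alternate-spow f zero    = alternate-one
alternate-spow f (suc k) n =
  trans (alternate-⊛ f (spow f k) n) (⊛-congʳ (alternate f) (alternate-spow f k) n)

alternate-∏ : ∀ fs → alternate (∏ fs) ≗ ∏ (map alternate fs)
alternate-∏ []       = alternate-one
alternate-∏ (f ∷ fs) n = trans (alternate-⊛ f (∏ fs) n) (⊛-congʳ (alternate f) (alternate-∏ fs) n)

NonNegative-one : NonNegative one
NonNegative-one zero    = +≤+ z≤n
NonNegative-one (suc n) = +≤+ z≤n

⊛-terms-nonNeg : ∀ {f g} → NonNegative f → NonNegative g →
                 ∀ n → All (0ℤ ℤ.≤_) (map (λ i → f i * g (n ∸ i)) (upTo (suc n)))
⊛-terms-nonNeg f≥0 g≥0 n = map⁺ (universal (λ i → 0≤i*j (f≥0 i) (g≥0 (n ∸ i))) (upTo (suc n)))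

NonNegative-⊛ : ∀ {f g} → NonNegative f → NonNegative g → NonNegative (f ⊛ g)
NonNegative-⊛ f≥0 g≥0 n = sumℤ-nonNeg (⊛-terms-nonNeg f≥0 g≥0 n)

NonNegative-spow : ∀ {f} → NonNegative f → ∀ k → NonNegative (spow f k)
NonNegative-spow f≥0 zero    = NonNegative-one
NonNegative-spow f≥0 (suc k) = NonNegative-⊛ f≥0 (NonNegative-spow f≥0 k)

NonNegative-∏ : ∀ {fs} → All NonNegative fs → NonNegative (∏ fs)
NonNegative-∏ []           = NonNegative-one
NonNegative-∏ (f≥0 ∷ fs≥0) = NonNegative-⊛ f≥0 (NonNegative-∏ fs≥0)

⊛-positive : ∀ {f g i j} → NonNegative f → NonNegative g →
             1ℤ ℤ.≤ f i → 1ℤ ℤ.≤ g j → 1ℤ ℤ.≤ (f ⊛ g) (i ℕ.+ j)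
⊛-positive {f} {g} {i} {j} f≥0 g≥0 fi≥1 gj≥1 = ℤ.≤-trans
  (1≤i*j fi≥1 (subst (λ k → 1ℤ ℤ.≤ g k) (sym (ℕ.m+n∸m≡n i j)) gj≥1))
  (∈⇒≤sumℤ (⊛-terms-nonNeg f≥0 g≥0 (i ℕ.+ j))
           (∈-map⁺ (λ k → f k * g (i ℕ.+ j ∸ k)) (∈-upTo⁺ (s≤s (ℕ.m≤m+n i j)))))

spow-positive-multiples : ∀ {f a} → NonNegative f → 1ℤ ℤ.≤ f 0 → 1ℤ ℤ.≤ f a →
                          ∀ {k r} → r ≤ k → 1ℤ ℤ.≤ spow f k (r ℕ.* a)
spow-positive-multiples f≥0 f₀≥1 fₐ≥1 {zero}  z≤n = ℤ.≤-refl
spow-positive-multiples f≥0 f₀≥1 fₐ≥1 {suc k} {zero} _ =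
  ⊛-positive {i = 0} {j = 0} f≥0 (NonNegative-spow f≥0 k) f₀≥1
    (spow-positive-multiples f≥0 f₀≥1 fₐ≥1 {k} {0} z≤n)
spow-positive-multiples f≥0 f₀≥1 fₐ≥1 {suc k} {suc r} (s≤s r≤k) =
  ⊛-positive f≥0 (NonNegative-spow f≥0 k) fₐ≥1 (spow-positive-multiples f≥0 f₀≥1 fₐ≥1 r≤k)

-1^odd : ∀ {n} → 2 ∤ n → -1ℤ ^ n ≡ -1ℤ
-1^odd {zero}        2∤0 = ⊥-elim (2∤0 (2 ∣0))
-1^odd {suc zero}    _   = refl
-1^odd {suc (suc n)} 2∤n+2 = begin
  -1ℤ * (-1ℤ * -1ℤ ^ n)   ≡⟨ ℤ.-1*i≡-i _ ⟩
  - (-1ℤ * -1ℤ ^ n)       ≡⟨ cong -_ (ℤ.-1*i≡-i _) ⟩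
  - - (-1ℤ ^ n)           ≡⟨ ℤ.neg-involutive _ ⟩
  -1ℤ ^ n                 ≡⟨ -1^odd (2∤n+2 ∘ ∣m∣n⇒∣m+n ∣-refl) ⟩
  -1ℤ                     ∎
  where open ≡-Reasoning

prime∤⇒∤^ : ∀ {q a} → Prime q → q ∤ a → ∀ i → q ∤ a ℕ.^ i
prime∤⇒∤^ q-prime q∤a zero    q∣1 = ¬prime[1] (subst Prime (∣1⇒≡1 q∣1) q-prime)
prime∤⇒∤^ {a = a} q-prime q∤a (suc i) q∣aⁱ⁺¹ =
  [ q∤a , prime∤⇒∤^ q-prime q∤a i ]′ (euclidsLemma a (a ℕ.^ i) q-prime q∣aⁱ⁺¹)

prime≥3⇒odd : ∀ {p} → Prime p → 3 ≤ p → 2 ∤ p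
prime≥3⇒odd p-prime 3≤p 2∣p = composite⇒¬prime (composite 3≤p 2∣p) p-prime

n<m^n : ∀ {m} → 1 < m → ∀ n → n < m ℕ.^ n
n<m^n 1<m zero    = ℕ.z<s
n<m^n {m} 1<m (suc n) = begin-strict
  suc n                 ≤⟨ n<m^n 1<m n ⟩
  m ℕ.^ n               <⟨ ℕ.m<m+n (m ℕ.^ n) (ℕ.≤-<-trans z≤n (n<m^n 1<m n)) ⟩
  m ℕ.^ n ℕ.+ m ℕ.^ n   ≡⟨ cong (m ℕ.^ n ℕ.+_) (ℕ.+-identityʳ (m ℕ.^ n)) ⟨
  2 ℕ.* m ℕ.^ n         ≤⟨ ℕ.*-monoˡ-≤ (m ℕ.^ n) 1<m ⟩
  m ℕ.* m ℕ.^ n         ∎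
  where open ℕ.≤-Reasoning

alternate-oneMinusXPow-nonNeg : ∀ {a} → 2 ∤ a → NonNegative (alternate (oneMinusXPow a))
alternate-oneMinusXPow-nonNeg 2∤a zero = +≤+ z≤n
alternate-oneMinusXPow-nonNeg {a} 2∤a (suc n) with suc n ℕ.≟ a
... | yes refl rewrite dec-true (suc n ℕ.≟ suc n) refl | -1^odd 2∤a = +≤+ z≤n
... | no n+1≢a rewrite dec-false (suc n ℕ.≟ a) n+1≢a = ℤ.≤-reflexive (sym (ℤ.*-zeroʳ (-1ℤ ^ suc n)))

alternate-oneMinusXPow-at : ∀ {a} → 2 ∤ a → alternate (oneMinusXPow a) a ≡ 1ℤ
alternate-oneMinusXPow-at {zero}  _   = refl
alternate-oneMinusXPow-at {suc a} 2∤a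
  rewrite dec-true (suc a ℕ.≟ suc a) refl | -1^odd 2∤a = refl

alternate-factorPow-nonNeg : ∀ {a} → 2 ∤ a → ∀ k → NonNegative (alternate (factorPow a (+ k)))
alternate-factorPow-nonNeg 2∤a k n = subst (0ℤ ℤ.≤_) (sym (alternate-spow _ k n))
  (NonNegative-spow (alternate-oneMinusXPow-nonNeg 2∤a) k n)

alternate-factorPow-positive : ∀ {a} → 2 ∤ a → ∀ {k r} → r ≤ k →
                               1ℤ ℤ.≤ alternate (factorPow a (+ k)) (r ℕ.* a)
alternate-factorPow-positive {a} 2∤a {k} {r} r≤k = subst (1ℤ ℤ.≤_) (sym (alternate-spow _ k (r ℕ.* a)))
  (spow-positive-multiples (alternate-oneMinusXPow-nonNeg 2∤a) ℤ.≤-refl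
    (ℤ.≤-reflexive (sym (alternate-oneMinusXPow-at 2∤a))) r≤k)

-- The i-th factor supplies the i-th base-p digit of t, whose place value is s·p^i.
∏-positive-below-power : ∀ {p} ⦃ _ : NonZero p ⦄ {s} (G : ℕ → Series) → (∀ i → NonNegative (G i)) →
                         (∀ i {r} → r < p → 1ℤ ℤ.≤ G i (r ℕ.* (s ℕ.* p ℕ.^ i))) →
                         ∀ L {t} → t < p ℕ.^ L → 1ℤ ℤ.≤ ∏ (applyUpTo G L) (t ℕ.* s)
∏-positive-below-power G G≥0 G-digits zero {zero}  _        = ℤ.≤-refl
∏-positive-below-power G G≥0 G-digits zero {suc t} (s≤s ())
∏-positive-below-power {p} {s} G G≥0 G-digits (suc L) {t} t<pᴸ⁺¹ =
  subst (λ k → 1ℤ ℤ.≤ ∏ (applyUpTo G (suc L)) k) (sym t*s≡lowDigit+highDigits)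
    (⊛-positive (G≥0 0) (NonNegative-∏ (applyUpTo⁺₂ (G ∘ suc) L (G≥0 ∘ suc))) lowDigit highDigits)
  where
  r q : ℕ
  r = t % p
  q = t / p
  expand : ∀ r q p s → (r ℕ.+ q ℕ.* p) ℕ.* s ≡ r ℕ.* s ℕ.+ q ℕ.* (s ℕ.* p)
  expand = ℕ-Solver.solve-∀
  t*s≡lowDigit+highDigits : t ℕ.* s ≡ r ℕ.* s ℕ.+ q ℕ.* (s ℕ.* p)
  t*s≡lowDigit+highDigits = trans (cong (ℕ._* s) (m≡m%n+[m/n]*n t p)) (expand r q p s)
  lowDigit : 1ℤ ℤ.≤ G 0 (r ℕ.* s)
  lowDigit = subst (λ k → 1ℤ ℤ.≤ G 0 (r ℕ.* k)) (ℕ.*-identityʳ s) (G-digits 0 (m%n<n t p))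
  highDigits : 1ℤ ℤ.≤ ∏ (applyUpTo (G ∘ suc) L) (q ℕ.* (s ℕ.* p))
  highDigits = ∏-positive-below-power (G ∘ suc) (G≥0 ∘ suc)
    (λ i {d} d<p → subst (λ k → 1ℤ ℤ.≤ G (suc i) (d ℕ.* k)) (sym (ℕ.*-assoc s p (p ℕ.^ i)))
                         (G-digits (suc i) d<p))
    L (m<n*o⇒m/o<n (subst (t <_) (ℕ.*-comm p (p ℕ.^ L)) t<pᴸ⁺¹))

alternate-generatingFunction-positive :
  ∀ {p e} → 2 ∤ p → 1 < p → p ∸ 1 ≤ e → ∀ k n →
  1ℤ ℤ.≤ alternate (factorPow 1 (+ k) ⊛ ∏ (map (λ i → factorPow (p ℕ.^ i) (+ e)) (upTo (suc n)))) n
alternate-generatingFunction-positive {p} {e} 2∤p 1<p@(s≤s _) p-1≤e k n =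
  subst (1ℤ ℤ.≤_) (sym (alternate-⊛ (factorPow 1 (+ k)) B n))
    (⊛-positive {i = 0} {j = n} (alternate-factorPow-nonNeg 2∤1 k) B≥0
      (alternate-factorPow-positive 2∤1 {k} {0} z≤n) Bₙ≥1)
  where
  2∤1 : 2 ∤ 1
  2∤1 = >⇒∤ (ℕ.n<1+n 1)
  F : ℕ → Series
  F i = factorPow (p ℕ.^ i) (+ e)
  B : Series
  B = ∏ (map F (upTo (suc n)))
  odd : ∀ i → 2 ∤ p ℕ.^ i
  odd = prime∤⇒∤^ prime[2] 2∤p
  G≥0 : ∀ i → NonNegative (alternate (F i))
  G≥0 i = alternate-factorPow-nonNeg (odd i) e
  G-digits : ∀ i {r} → r < p → 1ℤ ℤ.≤ alternate (F i) (r ℕ.* (1 ℕ.* p ℕ.^ i))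
  G-digits i {r} r<p = subst (λ k → 1ℤ ℤ.≤ alternate (F i) (r ℕ.* k)) (sym (ℕ.*-identityˡ (p ℕ.^ i)))
    (alternate-factorPow-positive (odd i) (ℕ.≤-trans (ℕ.<⇒≤pred r<p) p-1≤e))
  alternate-B : alternate B ≗ ∏ (applyUpTo (alternate ∘ F) (suc n))
  alternate-B m = trans (alternate-∏ (map F (upTo (suc n))) m)
    (cong (λ fs → ∏ fs m) (trans (sym (map-∘ {g = alternate} {f = F} (upTo (suc n))))
                                 (map-upTo (alternate ∘ F) (suc n))))
  B≥0 : NonNegative (alternate B)
  B≥0 m = subst (0ℤ ℤ.≤_) (sym (alternate-B m))
    (NonNegative-∏ (applyUpTo⁺₂ (alternate ∘ F) (suc n) G≥0) m)
  Bₙ≥1 : 1ℤ ℤ.≤ alternate B n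
  Bₙ≥1 = subst (1ℤ ℤ.≤_)
    (sym (trans (alternate-B n) (cong (∏ (applyUpTo (alternate ∘ F) (suc n))) (sym (ℕ.*-identityʳ n)))))
    (∏-positive-below-power (alternate ∘ F) G≥0 G-digits (suc n)
      (ℕ.<-trans (ℕ.n<1+n n) (n<m^n 1<p (suc n))))

alternate-d-positive : ∀ {p} → Prime p → 3 ≤ p → ∀ j n → 1ℤ ℤ.≤ alternate (d p -[1+ j ]) n
alternate-d-positive {p} p-prime 3≤p j n =
  subst (λ E → 1ℤ ℤ.≤ alternate (factorPow 1 (+ suc j) ⊛
                                 ∏ (map (λ i → factorPow (p ℕ.^ i) E) (upTo (suc n)))) n)
    (sym exponent)
    (alternate-generatingFunction-positive (prime≥3⇒odd p-prime 3≤p) (ℕ.<-trans (ℕ.n<1+n 1) 3≤p)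
      (ℕ.m≤m*n (p ∸ 1) (suc j)) (suc j) n)
  where
  exponent : - (+ (p ∸ 1) * -[1+ j ]) ≡ + ((p ∸ 1) ℕ.* suc j)
  exponent = trans (ℤ.neg-distribʳ-* (+ (p ∸ 1)) -[1+ j ]) (sym (ℤ.pos-* (p ∸ 1) (suc j)))

corollary3p8 : (p : ℕ) → Prime p → 3 ≤ p → (m : ℤ) → m ℤ.≤ -[1+ 0 ] → (n : ℕ) → d p m n ≢ + 0
corollary3p8 p p-prime 3≤p -[1+ j ] _ n dₙ≡0
  with subst (1ℤ ℤ.≤_) (trans (cong (-1ℤ ^ n *_) dₙ≡0) (ℤ.*-zeroʳ (-1ℤ ^ n)))
             (alternate-d-positive p-prime 3≤p j n)
... | +≤+ ()
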